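{- Let $n,k\ge1$ and $A=(l,\mathbf a,\mathbf m,\mathbf b)\in\mathcal A'(n,k)$, and let $c_1<\dots<c_s$ be the distinct values of $\mathbf a$. For every $r\in\{1,\dots,s\}$ and every positive integer $\beta$, the set $I_{r,\beta}=\{i: a_i\in\{c_1,\dots,c_r\},\ b_i=\beta\}$ has at most $r$ elements. If $|I_{r,\beta}|=r$, then the values $a_i$, $i\in I_{r,\beta}$, are pairwise distinct (the occurrences lie in different rows of $T(A)$), and every $i\in I_{r,\beta}$ satisfies $i\ge l+1$.
   Context: Fix integers $n,k\ge1$. For $\mathbf m\in\mathbb Z_{\ge0}^n$, $\mathbf b\in\mathbb Z_{\ge1}^n$ and distinct $i,j$, let $d_k^{i,j}(\mathbf m,\mathbf b)=k+m_j-m_i+\delta(b_i>b_j)$ if $m_i>m_j$, and $k-1+m_i-m_j+\delta(b_i<b_j)$ if $m_i\le m_j$ ($\delta$ = $0/1$ indicator). Order triples by $(a,m,b)\prec(a',m',b')$ iff $a<a'$, or $a=a'$ and $m>m'$, or $a=a'$, $m=m'$, $b<b'$. $\mathcal A(n,k)$ is the set of $(l,\mathbf a,\mathbf m,\mathbf b)$ with $l\in\{0,\dots,n\}$, $\mathbf a,\mathbf b\in\mathbb Z_{\ge1}^n$, $\mathbf m\in\mathbb Z_{\ge0}^n$ such that: (i) the triples $(a_i,m_i,b_i)$ are $\prec$-increasing for $l+1\le i\le n$ and $\prec$-decreasing for $1\le i\le l$; (ii) $m_i>0$ for $i\le l$; (iii) for $i<j$, if $m_j-k+1\le m_i\le m_j+k$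 then $b_i\ne b_j$. $\sigma_i$ is the rank of $(a_i,m_i,b_i)$ among all $n$ (distinct) triples in order $\prec$. $\mathrm{move}_i(A)$: change $l$ to $l-1$ if $i\le l$, to $l+1$ if $i>l$, removing the $i$-th triple and reinserting it into the block on the other side of the dividing position at the unique place making (i) hold. $i$ is $k$-movable if $\mathrm{move}_i(A)\in\mathcal A(n,k)$ and for all $j$ with $\sigma_j<\sigma_i$: $d_k^{i,j}(\mathbf m,\mathbf b)\le0$ and $d_k^{j,i}(\mathbf m,\mathbf b)\le0$. $\mathcal A'(n,k)$ is the set of $A\in\mathcal A(n,k)$ with no $k$-movable index. $T(A)$ is the diagram whose $r$-th row consists of the pairs $(m_i,b_i)$ for the $i$ with $a_i=c_r$; "position $i$ is to the right of the dividing line" means $i\ge l+1$. -}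

module Defs where

open import Data.Bool using (Bool; true; false; if_then_else_; _∧_)
open import Data.Nat using (ℕ; zero; suc; _+_; _∸_; _≤_; _<_; _<ᵇ_; _≡ᵇ_)
open import Data.Nat.Properties using (_≟_; _<?_; ≤-decTotalOrder)
open import Data.Integer as ℤ using (ℤ; +_)
open import Data.Fin using (Fin; toℕ)
open import Data.List using (allFin)
open import Data.Vec using (Vec; []; _∷_; toList; lookup)
open import Data.List using (List; take; length; filter; deduplicate)
open import Data.List.Membership.Propositional using (_∈_)
open import Data.List.Membership.DecPropositional _≟_ using (_∈?_)
open import Data.List.Sort ≤-decTotalOrder using (sort)
open import Data.Product using (_×_; _,_; Σ)
open import Data.Sum using (_⊎_)
open import Data.Empty using (⊥)
open import Relation.Nullary using (Dec; ¬_; does)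
open import Relation.Nullary.Decidable using (_⊎-dec_; _×-dec_)
open import Relation.Binary.PropositionalEquality using (_≡_)

-- Conventions: positions are 0-based; paper position i (1-based) is
-- our position i-1.  So "i ≤ l" (paper) is "q < l" here, and
-- "i ≥ l+1" (paper) is "l ≤ q" here.
-- A sequence of triples is a function ℕ → Triple; only entries at
-- positions < n matter.

Triple : Set
Triple = ℕ × ℕ × ℕ

aOf mOf bOf : Triple → ℕ
aOf (a , _ , _) = a
mOf (_ , m , _) = m
bOf (_ , _ , b) = b

_≺_ : Triple → Triple → Set
(a , m , b) ≺ (a' , m' , b') =
  (a < a') ⊎ ((a ≡ a' × m' < m) ⊎ (a ≡ a' × m ≡ m' × b < b'))

_≺?_ : (x y : Triple) → Dec (x ≺ y)
(a , m , b) ≺? (a' , m' , b') =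
  (a <? a') ⊎-dec (((a ≟ a') ×-dec (m' <? m)) ⊎-dec ((a ≟ a') ×-dec ((m ≟ m') ×-dec (b <? b'))))

count : (ℕ → Bool) → ℕ → ℕ
count f zero = 0
count f (suc n) = (if f n then 1 else 0) + count f n

record Config : Set where
  constructor cfg
  field
    ell : ℕ
    tr  : ℕ → Triple
open Config public

record InA (n k : ℕ) (C : Config) : Set where
  field
    l≤n     : ell C ≤ n
    a-pos   : ∀ q → q < n → 1 ≤ aOf (tr C q)
    b-pos   : ∀ q → q < n → 1 ≤ bOf (tr C q)
    incR    : ∀ p q → ell C ≤ p → p < q → q < n → tr C p ≺ tr C q
    decL    : ∀ p q → p < q → q < ell C → tr C q ≺ tr C p
    m-pos   : ∀ q → q < ell C → 0 < mOf (tr C q)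
    -- (iii)  m_q - k + 1 ≤ m_p ≤ m_q + k  (rearranged in ℕ)
    b-dist  : ∀ p q → p < q → q < n →
              mOf (tr C q) + 1 ≤ mOf (tr C p) + k →
              mOf (tr C p) ≤ mOf (tr C q) + k →
              ¬ (bOf (tr C p) ≡ bOf (tr C q))

σ : (n : ℕ) → Config → ℕ → ℕ
σ n C i = suc (count (λ q → does (tr C q ≺? tr C i)) n)

δ : Bool → ℤ
δ true = + 1
δ false = + 0

d : (k : ℕ) → Config → ℕ → ℕ → ℤ
d k C i j =
  if mj <ᵇ mi
  then (+ k ℤ.+ + mj) ℤ.- + mi ℤ.+ δ (bj <ᵇ bi)
  else ((+ k ℤ.- + 1) ℤ.+ + mi) ℤ.- + mj ℤ.+ δ (bi <ᵇ bj)
  where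
    mi = mOf (tr C i)
    mj = mOf (tr C j)
    bi = bOf (tr C i)
    bj = bOf (tr C j)

removeAt : ℕ → (ℕ → Triple) → ℕ → Triple
removeAt i t q = if q <ᵇ i then t q else t (suc q)

insertAt : ℕ → Triple → (ℕ → Triple) → ℕ → Triple
insertAt P x w q = if q <ᵇ P then w q else (if q ≡ᵇ P then x else w (q ∸ 1))

-- move_i : the i-th triple switches sides of the dividing position and is
-- reinserted at the place keeping the block ordered (i).
move : (n : ℕ) → Config → ℕ → Config
move n C i =
  if i <ᵇ ell C
  then cfg (ell C ∸ 1)
           (insertAt (ell C ∸ 1 + count (λ q → (ell C <ᵇ suc q) ∧ does (tr C q ≺? tr C i)) n)
                     (tr C i) (removeAt i (tr C)))
  else cfg (suc (ell C))
           (insertAt (count (λ q → does (tr C i ≺? tr C q)) (ell C))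
                     (tr C i) (removeAt i (tr C)))

Movable : (n k : ℕ) → Config → ℕ → Set
Movable n k C i =
  InA n k (move n C i) ×
  (∀ j → j < n → σ n C j < σ n C i →
     (d k C i j ℤ.≤ + 0) × (d k C j i ℤ.≤ + 0))

InA' : (n k : ℕ) → Config → Set
InA' n k C = InA n k C × (∀ i → i < n → ¬ Movable n k C i)

-- reading a vector at a natural-number position (0 beyond the end)
get : ∀ {n} → Vec ℕ n → ℕ → ℕ
get [] _ = 0
get (x ∷ xs) zero = x
get (x ∷ xs) (suc q) = get xs q

mkA : ∀ {n} → ℕ → Vec ℕ n → Vec ℕ n → Vec ℕ n → Config
mkA l a m b = cfg l (λ q → get a q , get m q , get b q)

distinctValues : ∀ {n} → Vec ℕ n → List ℕ
distinctValues a = sort (deduplicate _≟_ (toList a))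

InI : ∀ {n} → Vec ℕ n → Vec ℕ n → ℕ → ℕ → Fin n → Set
InI a b r β i = (lookup a i ∈ take r (distinctValues a)) × (lookup b i ≡ β)

InI? : ∀ {n} (a b : Vec ℕ n) (r β : ℕ) (i : Fin n) → Dec (InI a b r β i)
InI? a b r β i = (lookup a i ∈? take r (distinctValues a)) ×-dec (lookup b i ≟ β)

cardI : ∀ {n} → Vec ℕ n → Vec ℕ n → ℕ → ℕ → ℕ
cardI {n} a b r β = length (filter (InI? a b r β) (allFin n))

module Submission where

-- An index i all of whose ≺-smaller triples have m at least k + 1 below m_i can be moved across the
-- dividing line: d ≤ 0 against every smaller triple is then automatic, and the only pairs whose
-- relative order changes are far apart in m, so condition (iii) survives.  Hence in 𝒜′ every triple
-- is supported by a ≺-smaller one with m_i ≤ m_j + k, unless it lies right of the line with m_i = 0.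
-- Following supports gives m_i ≤ k · #{c < a_i}, so m_i ≤ k (r − 1) on I_{r,β}.  Triples with the
-- same b have m-values at distance ≥ k, and > k when the earlier position carries the larger value,
-- so at most r of them fit into [0, k (r − 1)].  When exactly r fit no room is wasted: none lies left
-- of the line (where m > 0), and m increases with the position, which on the right block forces a to
-- increase strictly.

open import Defs
open import Data.Nat using (ℕ; zero; suc; _+_; _*_; _∸_; _≤_; _<_; _<ᵇ_; _≡ᵇ_; z≤n; s≤s; z<s; NonZero; >-nonZero)
open import Data.Nat.Induction using (<-rec)
open import Data.Nat.Properties
open import Algebra.Properties.CommutativeSemigroup +-commutativeSemigroup using (x∙yz≈y∙xz)
open import Data.Bool using (Bool; true; false; if_then_else_; _∧_; _∨_)
open import Data.Bool.Properties using (∨-identityʳ; ∨-zeroʳ)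
open import Data.Empty using (⊥-elim)
open import Data.Fin using (Fin; toℕ)
import Data.Fin as Fin
open import Data.Fin.Properties using (toℕ<n; toℕ-injective)
open import Data.Integer as ℤ using (-[1+_]; _⊖_)
import Data.Integer.Properties as ℤ
open import Data.List using (List; []; _∷_; length; filter; take; tabulate)
open import Data.List.Membership.DecPropositional _≟_ using (_∈?_)
open import Data.List.Membership.Propositional using (_∈_)
open import Data.List.Membership.Propositional.Properties using (∈-deduplicate⁺)
open import Data.List.Properties using (filter-none)
open import Data.List.Relation.Binary.Permutation.Propositional using (↭-sym)
open import Data.List.Relation.Binary.Permutation.Propositional.Properties using (∈-resp-↭)
import Data.List.Relation.Unary.All as All
open import Data.List.Relation.Unary.Any using (here; there)
import Data.List.Relation.Unary.Linked as Linked
open import Data.List.Relation.Unary.Linked.Properties using (Linked⇒All)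
open import Data.List.Relation.Unary.Sorted.TotalOrder ≤-totalOrder using (Sorted)
open import Data.List.Sort ≤-decTotalOrder using (sort-↗; sort-↭)
open import Data.Product using (_×_; _,_; ∃; proj₁; proj₂)
open import Data.Sum using (_⊎_; inj₁; inj₂; [_,_]; map₂; swap)
open import Data.Vec using (Vec; _∷_; lookup; toList)
open import Function using (_∘_)
open import Function.Bundles using (mk⇔)
open import Relation.Binary.Definitions using (Trichotomous; Tri; tri<; tri≈; tri>)
open import Relation.Binary.PropositionalEquality
  using (_≡_; _≢_; refl; sym; trans; cong; cong₂; subst; subst₂; ≢-sym)
open import Relation.Nullary using (Dec; yes; no; ¬_; does; ofʸ; ofⁿ)
open import Relation.Nullary.Decidable using (dec-true; dec-false; does-⇔; _×-dec_)

witness : ∀ {P : Set} (P? : Dec P) → does P? ≡ true → P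
witness (yes p) _ = p

absurd-<≥ : ∀ {A : Set} {a b} → a < b → b ≤ a → A
absurd-<≥ a<b b≤a = ⊥-elim (<⇒≱ a<b b≤a)

≺-irrefl : ∀ x → ¬ (x ≺ x)
≺-irrefl _ (inj₁ a<a) = <-irrefl refl a<a
≺-irrefl _ (inj₂ (inj₁ (_ , m<m))) = <-irrefl refl m<m
≺-irrefl _ (inj₂ (inj₂ (_ , _ , b<b))) = <-irrefl refl b<b

≺-trans : ∀ {x y z} → x ≺ y → y ≺ z → x ≺ z
≺-trans (inj₁ p) (inj₁ q) = inj₁ (<-trans p q)
≺-trans (inj₁ p) (inj₂ (inj₁ (refl , _))) = inj₁ p
≺-trans (inj₁ p) (inj₂ (inj₂ (refl , _ , _))) = inj₁ p
≺-trans (inj₂ (inj₁ (refl , _))) (inj₁ q) = inj₁ q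
≺-trans (inj₂ (inj₂ (refl , _ , _))) (inj₁ q) = inj₁ q
≺-trans (inj₂ (inj₁ (refl , p))) (inj₂ (inj₁ (refl , q))) = inj₂ (inj₁ (refl , <-trans q p))
≺-trans (inj₂ (inj₁ (refl , p))) (inj₂ (inj₂ (refl , refl , _))) = inj₂ (inj₁ (refl , p))
≺-trans (inj₂ (inj₂ (refl , refl , _))) (inj₂ (inj₁ (refl , q))) = inj₂ (inj₁ (refl , q))
≺-trans (inj₂ (inj₂ (refl , refl , p))) (inj₂ (inj₂ (refl , refl , q))) = inj₂ (inj₂ (refl , refl , <-trans p q))

≺-asym : ∀ {x y} → x ≺ y → ¬ (y ≺ x)
≺-asym {x} p q = ≺-irrefl x (≺-trans p q)

≺-cmp : Trichotomous _≡_ _≺_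
≺-cmp x@(a , m , b) y@(a' , m' , b') = fromWeak weak
  where
    weak : x ≺ y ⊎ x ≡ y ⊎ y ≺ x
    weak with <-cmp a a' | <-cmp m m' | <-cmp b b'
    ... | tri< p _ _ | _ | _ = inj₁ (inj₁ p)
    ... | tri> _ _ p | _ | _ = inj₂ (inj₂ (inj₁ p))
    ... | tri≈ _ refl _ | tri< p _ _ | _ = inj₂ (inj₂ (inj₂ (inj₁ (refl , p))))
    ... | tri≈ _ refl _ | tri> _ _ p | _ = inj₁ (inj₂ (inj₁ (refl , p)))
    ... | tri≈ _ refl _ | tri≈ _ refl _ | tri< p _ _ = inj₁ (inj₂ (inj₂ (refl , refl , p)))
    ... | tri≈ _ refl _ | tri≈ _ refl _ | tri> _ _ p = inj₂ (inj₂ (inj₂ (inj₂ (refl , refl , p))))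
    ... | tri≈ _ refl _ | tri≈ _ refl _ | tri≈ _ refl _ = inj₂ (inj₁ refl)
    fromWeak : x ≺ y ⊎ x ≡ y ⊎ y ≺ x → Tri (x ≺ y) (x ≡ y) (y ≺ x)
    fromWeak (inj₁ x≺y) = tri< x≺y (λ { refl → ≺-irrefl x x≺y }) (≺-asym x≺y)
    fromWeak (inj₂ (inj₁ refl)) = tri≈ (≺-irrefl x) refl (≺-irrefl x)
    fromWeak (inj₂ (inj₂ y≺x)) = tri> (≺-asym y≺x) (λ { refl → ≺-irrefl x y≺x }) y≺x

≺⇒a<⊎m≥ : ∀ {x y} → x ≺ y → aOf x < aOf y ⊎ (aOf x ≡ aOf y × mOf y ≤ mOf x)
≺⇒a<⊎m≥ (inj₁ a<a') = inj₁ a<a'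
≺⇒a<⊎m≥ (inj₂ (inj₁ (a≡a' , m'<m))) = inj₂ (a≡a' , <⇒≤ m'<m)
≺⇒a<⊎m≥ (inj₂ (inj₂ (a≡a' , refl , _))) = inj₂ (a≡a' , ≤-refl)

count-mono : ∀ {f g : ℕ → Bool} n → (∀ q → q < n → f q ≡ true → g q ≡ true) → count f n ≤ count g n
count-mono zero _ = z≤n
count-mono {f} {g} (suc n) f⇒g with f n in fn | g n in gn | count-mono n (λ q q<n → f⇒g q (m<n⇒m<1+n q<n))
... | false | false | ih = ih
... | false | true  | ih = m≤n⇒m≤1+n ih
... | true  | true  | ih = s≤s ih
... | true  | false | _ with () ← trans (sym (f⇒g n ≤-refl fn)) gn

count-cong : ∀ {f g : ℕ → Bool} n → (∀ q → q < n → f q ≡ g q) → count f n ≡ count g n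
count-cong zero _ = refl
count-cong {f} {g} (suc n) f≡g =
  cong₂ _+_ (cong (λ c → if c then 1 else 0) (f≡g n ≤-refl)) (count-cong n (λ q q<n → f≡g q (m<n⇒m<1+n q<n)))

count-switchOn : ∀ {f g : ℕ → Bool} n x → x < n → f x ≡ false → g x ≡ true → (∀ q → q < n → q ≢ x → f q ≡ g q) →
  count g n ≡ suc (count f n)
count-switchOn {f} {g} (suc n) x x<1+n fx gx f≡g with <-cmp x n
... | tri< x<n x≢n _ rewrite f≡g n ≤-refl (λ n≡x → x≢n (sym n≡x)) =
  trans (cong ((if g n then 1 else 0) +_) (count-switchOn n x x<n fx gx (λ q q<n → f≡g q (m<n⇒m<1+n q<n))))
        (+-suc _ (count f n))
... | tri≈ _ refl _ rewrite fx | gx =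
  cong suc (sym (count-cong x (λ q q<x → f≡g q (m<n⇒m<1+n q<x) (<⇒≢ q<x))))
... | tri> _ _ n<x = ⊥-elim (<⇒≱ x<1+n n<x)

count-< : ∀ {f g : ℕ → Bool} n → (∀ q → q < n → f q ≡ true → g q ≡ true) → ∀ x → x < n → f x ≡ false → g x ≡ true →
  count f n < count g n
count-< {f} {g} n f⇒g x x<n fx gx = begin-strict
    count f n <⟨ n<1+n (count f n) ⟩
    suc (count f n) ≡⟨ count-switchOn n x x<n fx (trans (cong (f x ∨_) (dec-true (x ≟ x) refl)) (∨-zeroʳ (f x))) f≡f+x ⟨
    count f+x n ≤⟨ count-mono n f+x⇒g ⟩
    count g n ∎
  where
    open ≤-Reasoning
    f+x : ℕ → Bool
    f+x q = f q ∨ (q ≡ᵇ x)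
    f≡f+x : ∀ q → q < n → q ≢ x → f q ≡ f+x q
    f≡f+x q _ q≢x rewrite dec-false (q ≟ x) q≢x = sym (∨-identityʳ (f q))
    f+x⇒g : ∀ q → q < n → f+x q ≡ true → g q ≡ true
    f+x⇒g q q<n e with q ≟ x | f q in fq
    ... | _ | true = f⇒g q q<n fq
    ... | yes refl | false = gx
    ... | no q≢x | false with () ← trans (sym e) (dec-false (q ≟ x) q≢x)

count-none : ∀ {f : ℕ → Bool} n → (∀ q → q < n → f q ≡ false) → count f n ≡ 0
count-none zero _ = refl
count-none {f} (suc n) none rewrite none n ≤-refl = count-none n (λ q q<n → none q (m<n⇒m<1+n q<n))

count-segment : ∀ {f : ℕ → Bool} A n → A ≤ n → (∀ q → q < A → f q ≡ false) →
  (∀ p q → A ≤ p → p < q → q < n → f q ≡ true → f p ≡ true) →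
  (A + count f n ≤ n) × (∀ q → A ≤ q → q < n → f q ≡ true → q < A + count f n) ×
  (∀ q → A ≤ q → q < A + count f n → f q ≡ true)
count-segment zero zero _ _ _ = z≤n , (λ _ _ ()) , (λ _ _ ())
count-segment (suc A) zero () _ _
count-segment {f} A (suc n) A≤1+n below downClosed with m≤n⇒m<n∨m≡n A≤1+n
... | inj₂ refl rewrite count-none (suc n) below | +-identityʳ (suc n) =
  ≤-refl , (λ q A≤q q<A _ → ⊥-elim (<⇒≱ q<A A≤q)) , (λ q A≤q q<A → ⊥-elim (<⇒≱ q<A A≤q))
... | inj₁ (s≤s A≤n) with count-segment A n A≤n below (λ p q A≤p p<q q<n → downClosed p q A≤p p<q (m<n⇒m<1+n q<n))
...   | bound , inside , segment with f n in fn
...     | false = m≤n⇒m≤1+n bound , inside′ , segment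
  where
    inside′ : ∀ q → A ≤ q → q < suc n → f q ≡ true → q < A + count f n
    inside′ q A≤q q<1+n fq with m≤n⇒m<n∨m≡n q<1+n
    ... | inj₁ (s≤s q<n) = inside q A≤q q<n fq
    ... | inj₂ refl with () ← trans (sym fq) fn
...     | true = ≤-reflexive total , (λ q _ q<1+n _ → subst (q <_) (sym total) q<1+n) , segment′
  where
    total : A + suc (count f n) ≡ suc n
    total with m≤n⇒m<n∨m≡n bound
    ... | inj₂ e = trans (+-suc A _) (cong suc e)
    ... | inj₁ short = ⊥-elim (<-irrefl refl (inside _ (m≤m+n A _) short (downClosed _ n (m≤m+n A _) short ≤-refl fn)))
    segment′ : ∀ q → A ≤ q → q < A + suc (count f n) → f q ≡ true
    segment′ q A≤q q<total with m≤n⇒m<n∨m≡n (subst (q <_) total q<total)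
    ... | inj₁ (s≤s q<n) = downClosed q n A≤q q<n ≤-refl fn
    ... | inj₂ refl = fn

search< : ∀ {P : ℕ → Set} → (∀ q → Dec (P q)) → ∀ n → (∃ λ q → q < n × P q) ⊎ (∀ q → q < n → ¬ P q)
search< P? zero = inj₂ (λ _ ())
search< P? (suc n) with P? n | search< P? n
... | yes p | _ = inj₁ (n , ≤-refl , p)
... | no _ | inj₁ (q , q<n , p) = inj₁ (q , m<n⇒m<1+n q<n , p)
... | no ¬pn | inj₂ none = inj₂ none′
  where
    none′ : ∀ q → q < suc n → ¬ _
    none′ q q<1+n with m≤n⇒m<n∨m≡n q<1+n
    ... | inj₁ (s≤s q<n) = none q q<n
    ... | inj₂ refl = ¬pn

-- Relocating one entry

module _ {P : ℕ} {x : Triple} {w : ℕ → Triple} where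

  insertAt-< : ∀ {q} → q < P → insertAt P x w q ≡ w q
  insertAt-< {q} q<P rewrite dec-true (q <? P) q<P = refl

  insertAt-≡ : insertAt P x w P ≡ x
  insertAt-≡ rewrite dec-false (P <? P) (<-irrefl refl) | dec-true (P ≟ P) refl = refl

  insertAt-> : ∀ {q} → P ≤ q → insertAt P x w (suc q) ≡ w q
  insertAt-> {q} P≤q
    rewrite dec-false (suc q <? P) (≤⇒≯ (m≤n⇒m≤1+n P≤q)) | dec-false (suc q ≟ P) (>⇒≢ (s≤s P≤q)) = refl

module _ {i : ℕ} {t : ℕ → Triple} where

  removeAt-< : ∀ {q} → q < i → removeAt i t q ≡ t q
  removeAt-< {q} q<i rewrite dec-true (q <? i) q<i = refl

  removeAt-≥ : ∀ {q} → i ≤ q → removeAt i t q ≡ t (suc q)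
  removeAt-≥ {q} i≤q rewrite dec-false (q <? i) (≤⇒≯ i≤q) = refl

module _ (t : ℕ → Triple) (P i : ℕ) where

  data LeftwardView : ℕ → Set where
    below   : ∀ {q} → q < P → insertAt P (t i) (removeAt i t) q ≡ t q → LeftwardView q
    at      : insertAt P (t i) (removeAt i t) P ≡ t i → LeftwardView P
    shifted : ∀ {q} → P ≤ q → q < i → insertAt P (t i) (removeAt i t) (suc q) ≡ t q → LeftwardView (suc q)
    above   : ∀ {q} → i < q → insertAt P (t i) (removeAt i t) q ≡ t q → LeftwardView q

  data RightwardView : ℕ → Set where
    below   : ∀ {q} → q < i → insertAt P (t i) (removeAt i t) q ≡ t q → RightwardView q
    shifted : ∀ {q} → i ≤ q → q < P → insertAt P (t i) (removeAt i t) q ≡ t (suc q) → RightwardView q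
    at      : insertAt P (t i) (removeAt i t) P ≡ t i → RightwardView P
    above   : ∀ {q} → P < q → insertAt P (t i) (removeAt i t) q ≡ t q → RightwardView q

  private
    ins-< : ∀ {q} → q < P → insertAt P (t i) (removeAt i t) q ≡ removeAt i t q
    ins-< = insertAt-< {P} {t i} {removeAt i t}
    ins-≡ : insertAt P (t i) (removeAt i t) P ≡ t i
    ins-≡ = insertAt-≡ {P} {t i} {removeAt i t}
    ins-> : ∀ {q} → P ≤ q → insertAt P (t i) (removeAt i t) (suc q) ≡ removeAt i t q
    ins-> = insertAt-> {P} {t i} {removeAt i t}
    rem-< : ∀ {q} → q < i → removeAt i t q ≡ t q
    rem-< = removeAt-< {i} {t}
    rem-≥ : ∀ {q} → i ≤ q → removeAt i t q ≡ t (suc q)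
    rem-≥ = removeAt-≥ {i} {t}

  leftwardView : P ≤ i → ∀ q → LeftwardView q
  leftwardView P≤i q with <-cmp q P
  ... | tri< q<P _ _ = below q<P (trans (ins-< q<P) (rem-< (<-≤-trans q<P P≤i)))
  ... | tri≈ _ refl _ = at ins-≡
  leftwardView P≤i (suc q) | tri> _ _ P<1+q with <-cmp q i
  ... | tri< q<i _ _ = shifted (≤-pred P<1+q) q<i (trans (ins-> (≤-pred P<1+q)) (rem-< q<i))
  ... | tri≈ _ refl _ = above ≤-refl (trans (ins-> (≤-pred P<1+q)) (rem-≥ ≤-refl))
  ... | tri> _ _ i<q = above (m<n⇒m<1+n i<q) (trans (ins-> (≤-pred P<1+q)) (rem-≥ (<⇒≤ i<q)))

  rightwardView : i ≤ P → ∀ q → RightwardView q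
  rightwardView i≤P q with <-cmp q P | q <? i
  ... | tri< q<P _ _ | yes q<i = below q<i (trans (ins-< q<P) (rem-< q<i))
  ... | tri< q<P _ _ | no q≮i = shifted (≮⇒≥ q≮i) q<P (trans (ins-< q<P) (rem-≥ (≮⇒≥ q≮i)))
  ... | tri≈ _ refl _ | _ = at ins-≡
  rightwardView i≤P (suc q) | tri> _ _ P<1+q | _ =
    above P<1+q (trans (ins-> (≤-pred P<1+q)) (rem-≥ (≤-trans i≤P (≤-pred P<1+q))))

-- Moving an unsupported index across the line

along : ∀ (R : Triple → Triple → Set) {x y x′ y′} → x ≡ x′ → y ≡ y′ → R x′ y′ → R x y
along R refl refl r = r

-- Condition (iii) for the pair (x, y) with x at the smaller position.
Compatible : ℕ → Triple → Triple → Set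
Compatible k x y = mOf y + 1 ≤ mOf x + k → mOf x ≤ mOf y + k → ¬ (bOf x ≡ bOf y)

far⇒compatible : ∀ {k x y} → mOf x + k < mOf y ⊎ mOf y + k < mOf x → Compatible k x y
far⇒compatible (inj₁ x≪y) y+1≤x+k _ _ = absurd-<≥ x≪y (≤-trans (m≤m+n _ 1) y+1≤x+k)
far⇒compatible (inj₂ y≪x) _ x≤y+k _ = absurd-<≥ y≪x x≤y+k

module _ {n l : ℕ} {t : ℕ → Triple} where

  move-fromLeft : ∀ {i} → i < l → move n (cfg l t) i ≡
    cfg (l ∸ 1) (insertAt (l ∸ 1 + count (λ q → (l <ᵇ suc q) ∧ does (t q ≺? t i)) n) (t i) (removeAt i t))
  move-fromLeft {i} i<l rewrite dec-true (i <? l) i<l = refl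

  move-fromRight : ∀ {i} → l ≤ i → move n (cfg l t) i ≡
    cfg (suc l) (insertAt (count (λ q → does (t i ≺? t q)) l) (t i) (removeAt i t))
  move-fromRight {i} l≤i rewrite dec-false (i <? l) (≤⇒≯ l≤i) = refl

⊖-negative : ∀ {a c} → a < c → a ⊖ c ℤ.≤ -[1+ 0 ]
⊖-negative a<c = subst (ℤ._≤ -[1+ 0 ]) (sym (ℤ.⊖-< a<c)) (ℤ.neg-mono-≤ (ℤ.+≤+ (m<n⇒0<n∸m a<c)))

-- δ contributes at most 1, so a strictly negative difference keeps d nonpositive.
difference+δ-nonpositive : ∀ {a c} e → a < c → ℤ.+ a ℤ.- ℤ.+ c ℤ.+ δ e ℤ.≤ ℤ.+ 0
difference+δ-nonpositive {a} {c} e a<c = begin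
  ℤ.+ a ℤ.- ℤ.+ c ℤ.+ δ e  ≡⟨ cong (ℤ._+ δ e) (ℤ.m-n≡m⊖n a c) ⟩
  a ⊖ c ℤ.+ δ e            ≤⟨ ℤ.+-mono-≤ (⊖-negative a<c) (δ≤1 e) ⟩
  ℤ.+ 0                    ∎
  where
    open ℤ.≤-Reasoning
    δ≤1 : ∀ e → δ e ℤ.≤ ℤ.+ 1
    δ≤1 false = ℤ.+≤+ z≤n
    δ≤1 true = ℤ.≤-refl

d-nonpositive : ∀ k C i j → 1 ≤ k → mOf (tr C j) + k < mOf (tr C i) →
  (d k C i j ℤ.≤ ℤ.+ 0) × (d k C j i ℤ.≤ ℤ.+ 0)
d-nonpositive (suc k′) C i j _ mj+k<mi
  rewrite dec-true (mOf (tr C j) <? mOf (tr C i)) (≤-<-trans (m≤m+n _ (suc k′)) mj+k<mi)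
        | dec-false (mOf (tr C i) <? mOf (tr C j)) (<⇒≯ (≤-<-trans (m≤m+n _ (suc k′)) mj+k<mi)) =
  difference+δ-nonpositive bj<bi (subst (_< mOf (tr C i)) (+-comm (mOf (tr C j)) (suc k′)) mj+k<mi) ,
  difference+δ-nonpositive bj<bi
    (≤-<-trans (≤-reflexive (+-comm k′ _)) (≤-<-trans (+-monoʳ-≤ _ (n≤1+n k′)) mj+k<mi))
  where
    bj<bi : Bool
    bj<bi = bOf (tr C j) <ᵇ bOf (tr C i)

module Configuration {n k l : ℕ} {t : ℕ → Triple} (A : InA n k (cfg l t)) where
  open InA A

  aAt mAt bAt : ℕ → ℕ
  aAt q = aOf (t q)
  mAt q = mOf (t q)
  bAt q = bOf (t q)

  b-gap : ∀ {p q} → p < q → q < n → bAt p ≡ bAt q → mAt p + k ≤ mAt q ⊎ mAt q + k < mAt p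
  b-gap {p} {q} p<q q<n bp≡bq with mAt p + k ≤? mAt q | mAt q + k <? mAt p
  ... | yes near | _ = inj₁ near
  ... | no _ | yes far = inj₂ far
  ... | no q<p+k | no q+k≮p =
    ⊥-elim (b-dist p q p<q q<n (subst (_≤ mAt p + k) (+-comm 1 (mAt q)) (≰⇒> q<p+k)) (≮⇒≥ q+k≮p) bp≡bq)

  tr-injective : 1 ≤ k → ∀ {p q} → p < q → q < n → t p ≢ t q
  tr-injective 1≤k {p} {q} p<q q<n tp≡tq with b-gap p<q q<n (cong bOf tp≡tq)
  ... | inj₁ p+k≤q = absurd-<≥ (m<m+n (mAt p) 1≤k) (subst (λ x → mAt p + k ≤ mOf x) (sym tp≡tq) p+k≤q)
  ... | inj₂ q+k<p = <-irrefl refl (<-trans (m<m+n (mAt q) 1≤k) (subst (λ x → mAt q + k < mOf x) tp≡tq q+k<p))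

  ≺⇒σ< : ∀ {i j} → j < n → t j ≺ t i → σ n (cfg l t) j < σ n (cfg l t) i
  ≺⇒σ< {i} {j} j<n j≺i = s≤s (count-< n
    (λ q _ q≺j → dec-true (t q ≺? t i) (≺-trans (witness (t q ≺? t j) q≺j) j≺i))
    j j<n (dec-false (t j ≺? t j) (≺-irrefl (t j))) (dec-true (t j ≺? t i) j≺i))

  σ<⇒≺ : ∀ {i j} → i < n → σ n (cfg l t) j < σ n (cfg l t) i → t j ≺ t i
  σ<⇒≺ {i} {j} i<n σj<σi with ≺-cmp (t j) (t i)
  ... | tri< j≺i _ _ = j≺i
  ... | tri≈ _ tj≡ti _ =
    ⊥-elim (<-irrefl (cong suc (count-cong n (λ q _ → cong (λ x → does (t q ≺? x)) tj≡ti))) σj<σi)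
  ... | tri> _ _ i≺j = ⊥-elim (<-asym σj<σi (≺⇒σ< i<n i≺j))

  Unsupported : ℕ → Set
  Unsupported i = ∀ j → j < n → t j ≺ t i → mAt j + k < mAt i

  right-block-m<⇒a< : ∀ {p q} → l ≤ p → p < q → q < n → mAt p < mAt q → aAt p < aAt q
  right-block-m<⇒a< {p} {q} l≤p p<q q<n mp<mq with ≺⇒a<⊎m≥ (incR p q l≤p p<q q<n)
  ... | inj₁ ap<aq = ap<aq
  ... | inj₂ (_ , mq≤mp) = absurd-<≥ mp<mq mq≤mp

  module MoveLeft (1≤k : 1 ≤ k) {i : ℕ} (l≤i : l ≤ i) (i<n : i < n) (0<mi : 0 < mAt i)
                  (unsupported : Unsupported i) where

    P : ℕ
    P = count (λ q → does (t i ≺? t q)) l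

    private
      segment : (P ≤ l) × (∀ q → 0 ≤ q → q < l → does (t i ≺? t q) ≡ true → q < P) ×
                (∀ q → 0 ≤ q → q < P → does (t i ≺? t q) ≡ true)
      segment = count-segment {λ q → does (t i ≺? t q)} 0 l z≤n (λ _ ())
        (λ p q _ p<q q<l i≺q → dec-true (t i ≺? t p) (≺-trans (witness (t i ≺? t q) i≺q) (decL p q p<q q<l)))

    P≤l : P ≤ l
    P≤l = proj₁ segment

    P≤i : P ≤ i
    P≤i = ≤-trans P≤l l≤i

    ≻-before-P : ∀ {q} → q < P → t i ≺ t q
    ≻-before-P q<P = witness (t i ≺? t _) (proj₂ (proj₂ segment) _ z≤n q<P)

    ≺-from-P : ∀ {q} → P ≤ q → q < i → t q ≺ t i
    ≺-from-P {q} P≤q q<i with q <? l | ≺-cmp (t q) (t i)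
    ... | no q≮l | _ = incR q i (≮⇒≥ q≮l) q<i i<n
    ... | yes _ | tri< q≺i _ _ = q≺i
    ... | yes _ | tri≈ _ tq≡ti _ = ⊥-elim (tr-injective 1≤k q<i i<n tq≡ti)
    ... | yes q<l | tri> _ _ i≺q = absurd-<≥ (proj₁ (proj₂ segment) q z≤n q<l (dec-true (t i ≺? t q) i≺q)) P≤q

    t′ : ℕ → Triple
    t′ = insertAt P (t i) (removeAt i t)

    private
      view : ∀ q → LeftwardView t P i q
      view = leftwardView t P i P≤i

    entries : ∀ {q} → q < n → ∃ λ q′ → q′ < n × t′ q ≡ t q′
    entries {q} q<n with view q
    ... | below _ e = q , q<n , e
    ... | at e = i , i<n , e
    ... | shifted _ q′<i e = _ , <-trans q′<i i<n , e
    ... | above _ e = q , q<n , e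

    incR′ : ∀ p q → suc l ≤ p → p < q → q < n → t′ p ≺ t′ q
    incR′ p q l<p p<q q<n with view p | view q
    ... | below p<P _ | _ = absurd-<≥ l<p (≤-trans (<⇒≤ p<P) P≤l)
    ... | at _ | _ = absurd-<≥ l<p P≤l
    ... | shifted P≤p′ _ _ | below q<P _ = absurd-<≥ q<P (≤-trans P≤p′ (<⇒≤ (<-trans (n<1+n _) p<q)))
    ... | shifted P≤p′ _ _ | at _ = absurd-<≥ p<q (≤-trans P≤p′ (n≤1+n _))
    ... | shifted _ _ e₁ | shifted _ _ e₂ = along _≺_ e₁ e₂ (incR _ _ (≤-pred l<p) (≤-pred p<q) (<-trans (n<1+n _) q<n))
    ... | shifted _ p′<i e₁ | above i<q e₂ = along _≺_ e₁ e₂ (incR _ q (≤-pred l<p) (<-trans p′<i i<q) q<n)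
    ... | above i<p _ | below q<P _ = absurd-<≥ q<P (≤-trans P≤i (<⇒≤ (<-trans i<p p<q)))
    ... | above i<p _ | at _ = absurd-<≥ p<q (≤-trans P≤i (<⇒≤ i<p))
    ... | above i<p _ | shifted _ q′<i _ = absurd-<≥ q′<i (≤-trans (<⇒≤ i<p) (≤-pred p<q))
    ... | above i<p e₁ | above _ e₂ = along _≺_ e₁ e₂ (incR p q (≤-trans l≤i (<⇒≤ i<p)) p<q q<n)

    decL′ : ∀ p q → p < q → q < suc l → t′ q ≺ t′ p
    decL′ p q p<q q≤l with view p | view q
    ... | _ | above i<q _ = absurd-<≥ i<q (≤-trans (≤-pred q≤l) l≤i)
    ... | above i<p _ | _ = absurd-<≥ (<-trans i<p p<q) (≤-trans (≤-pred q≤l) l≤i)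
    ... | below _ e₁ | below q<P e₂ = along _≺_ e₂ e₁ (decL p q p<q (<-≤-trans q<P P≤l))
    ... | below p<P e₁ | at e₂ = along _≺_ e₂ e₁ (≻-before-P p<P)
    ... | below p<P e₁ | shifted P≤q′ _ e₂ = along _≺_ e₂ e₁ (decL p _ (<-≤-trans p<P P≤q′) (≤-pred q≤l))
    ... | at e₁ | shifted P≤q′ q′<i e₂ = along _≺_ e₂ e₁ (≺-from-P P≤q′ q′<i)
    ... | shifted _ _ e₁ | shifted _ _ e₂ = along _≺_ e₂ e₁ (decL _ _ (≤-pred p<q) (≤-pred q≤l))
    ... | at _ | below q<P _ = absurd-<≥ p<q (<⇒≤ q<P)
    ... | at _ | at _ = absurd-<≥ p<q ≤-refl
    ... | shifted P≤p′ _ _ | below q<P _ = absurd-<≥ q<P (≤-trans P≤p′ (<⇒≤ (<-trans (n<1+n _) p<q)))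
    ... | shifted P≤p′ _ _ | at _ = absurd-<≥ p<q (≤-trans P≤p′ (n≤1+n _))

    m-pos′ : ∀ q → q < suc l → 0 < mOf (t′ q)
    m-pos′ q q≤l with view q
    ... | below q<P e = subst (λ x → 0 < mOf x) (sym e) (m-pos q (<-≤-trans q<P P≤l))
    ... | at e = subst (λ x → 0 < mOf x) (sym e) 0<mi
    ... | shifted _ _ e = subst (λ x → 0 < mOf x) (sym e) (m-pos _ (≤-pred q≤l))
    ... | above i<q _ = absurd-<≥ i<q (≤-trans (≤-pred q≤l) l≤i)

    b-dist′ : ∀ p q → p < q → q < n → Compatible k (t′ p) (t′ q)
    b-dist′ p q p<q q<n with view p | view q
    ... | below _ e₁ | below _ e₂ = along (Compatible k) e₁ e₂ (b-dist p q p<q q<n)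
    ... | below p<P e₁ | at e₂ = along (Compatible k) e₁ e₂ (b-dist p i (<-≤-trans p<P P≤i) i<n)
    ... | below p<P e₁ | shifted P≤q′ q′<i e₂ =
      along (Compatible k) e₁ e₂ (b-dist p _ (<-≤-trans p<P P≤q′) (<-trans q′<i i<n))
    ... | below _ e₁ | above _ e₂ = along (Compatible k) e₁ e₂ (b-dist p q p<q q<n)
    ... | at e₁ | shifted {q′} P≤q′ q′<i e₂ = along (Compatible k) e₁ e₂
      (far⇒compatible {k} {t i} {t q′} (inj₂ (unsupported q′ (<-trans q′<i i<n) (≺-from-P P≤q′ q′<i))))
    ... | at e₁ | above i<q e₂ = along (Compatible k) e₁ e₂ (b-dist i q i<q q<n)
    ... | shifted _ _ e₁ | shifted _ q′<i e₂ = along (Compatible k) e₁ e₂ (b-dist _ _ (≤-pred p<q) (<-trans q′<i i<n))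
    ... | shifted _ p′<i e₁ | above i<q e₂ = along (Compatible k) e₁ e₂ (b-dist _ q (<-trans p′<i i<q) q<n)
    ... | above _ e₁ | above _ e₂ = along (Compatible k) e₁ e₂ (b-dist p q p<q q<n)
    ... | at _ | below q<P _ = absurd-<≥ p<q (<⇒≤ q<P)
    ... | at _ | at _ = absurd-<≥ p<q ≤-refl
    ... | shifted P≤p′ _ _ | below q<P _ = absurd-<≥ q<P (≤-trans P≤p′ (<⇒≤ (<-trans (n<1+n _) p<q)))
    ... | shifted P≤p′ _ _ | at _ = absurd-<≥ p<q (≤-trans P≤p′ (n≤1+n _))
    ... | above i<p _ | below q<P _ = absurd-<≥ q<P (≤-trans P≤i (<⇒≤ (<-trans i<p p<q)))
    ... | above i<p _ | at _ = absurd-<≥ p<q (≤-trans P≤i (<⇒≤ i<p))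
    ... | above i<p _ | shifted _ q′<i _ = absurd-<≥ q′<i (≤-trans (<⇒≤ i<p) (≤-pred p<q))

    moved-InA : InA n k (cfg (suc l) t′)
    moved-InA = record
      { l≤n = <-≤-trans (s≤s l≤i) i<n
      ; a-pos = λ q q<n → let (q′ , q′<n , e) = entries q<n in subst (λ x → 1 ≤ aOf x) (sym e) (a-pos q′ q′<n)
      ; b-pos = λ q q<n → let (q′ , q′<n , e) = entries q<n in subst (λ x → 1 ≤ bOf x) (sym e) (b-pos q′ q′<n)
      ; incR = incR′
      ; decL = decL′
      ; m-pos = m-pos′
      ; b-dist = b-dist′
      }

  module MoveRight (1≤k : 1 ≤ k) {i : ℕ} (i<l : i < l) (unsupported : Unsupported i) where

    L : ℕ
    L = l ∸ 1

    R : ℕ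
    R = count (λ q → (l <ᵇ suc q) ∧ does (t q ≺? t i)) n

    P : ℕ
    P = L + R

    private
      l≡1+L : l ≡ suc L
      l≡1+L = sym (suc-pred l ⦃ >-nonZero (≤-<-trans z≤n i<l) ⦄)

      i<n : i < n
      i<n = <-≤-trans i<l l≤n

      ≺i⇒inR : ∀ {q} → l ≤ q → t q ≺ t i → (l <ᵇ suc q) ∧ does (t q ≺? t i) ≡ true
      ≺i⇒inR {q} l≤q q≺i rewrite dec-true (l <? suc q) (s≤s l≤q) = dec-true (t q ≺? t i) q≺i

      inR⇒≺i : ∀ {q} → (l <ᵇ suc q) ∧ does (t q ≺? t i) ≡ true → t q ≺ t i
      inR⇒≺i {q} e with l <ᵇ suc q
      ... | true = witness (t q ≺? t i) e

      segment : (l + R ≤ n) × (∀ q → l ≤ q → q < n → (l <ᵇ suc q) ∧ does (t q ≺? t i) ≡ true → q < l + R) ×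
                (∀ q → l ≤ q → q < l + R → (l <ᵇ suc q) ∧ does (t q ≺? t i) ≡ true)
      segment = count-segment {λ q → (l <ᵇ suc q) ∧ does (t q ≺? t i)} l n l≤n
        (λ q q<l → cong (_∧ does (t q ≺? t i)) (dec-false (l <? suc q) (≤⇒≯ q<l)))
        (λ p q l≤p p<q q<n q∈R → ≺i⇒inR l≤p (≺-trans (incR p q l≤p p<q q<n) (inR⇒≺i q∈R)))

      L<⇒l≤ : ∀ {q} → L < q → l ≤ q
      L<⇒l≤ = subst (_≤ _) (sym l≡1+L)

      <L⇒1+<l : ∀ {q} → q < L → suc q < l
      <L⇒1+<l q<L = subst (suc _ <_) (sym l≡1+L) (s≤s q<L)

      l+R≡1+P : l + R ≡ suc P
      l+R≡1+P = cong (_+ R) l≡1+L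

    1+P≤n : suc P ≤ n
    1+P≤n = subst (_≤ n) l+R≡1+P (proj₁ segment)

    i≤L : i ≤ L
    i≤L = ≤-pred (subst (i <_) l≡1+L i<l)

    L≤P : L ≤ P
    L≤P = m≤m+n L R

    i≤P : i ≤ P
    i≤P = ≤-trans i≤L L≤P

    ≺-upto-P : ∀ {q} → i < q → q ≤ P → t q ≺ t i
    ≺-upto-P {q} i<q q≤P with q <? l
    ... | yes q<l = decL i q i<q q<l
    ... | no q≮l = inR⇒≺i (proj₂ (proj₂ segment) q (≮⇒≥ q≮l) (subst (q <_) (sym l+R≡1+P) (s≤s q≤P)))

    ≻-after-P : ∀ {q} → P < q → q < n → t i ≺ t q
    ≻-after-P {q} P<q q<n with ≺-cmp (t q) (t i)
    ... | tri< q≺i _ _ =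
      absurd-<≥ (subst (q <_) l+R≡1+P (proj₁ (proj₂ segment) q l≤q q<n (≺i⇒inR l≤q q≺i))) P<q
      where
        l≤q : l ≤ q
        l≤q = L<⇒l≤ (≤-<-trans L≤P P<q)
    ... | tri≈ _ tq≡ti _ = ⊥-elim (tr-injective 1≤k (≤-<-trans i≤P P<q) q<n (sym tq≡ti))
    ... | tri> _ _ i≺q = i≺q

    t′ : ℕ → Triple
    t′ = insertAt P (t i) (removeAt i t)

    private
      view : ∀ q → RightwardView t P i q
      view = rightwardView t P i i≤P

    entries : ∀ {q} → q < n → ∃ λ q′ → q′ < n × t′ q ≡ t q′
    entries {q} q<n with view q
    ... | below _ e = q , q<n , e
    ... | shifted _ q<P e = suc q , <-≤-trans (s≤s q<P) 1+P≤n , e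
    ... | at e = i , i<n , e
    ... | above _ e = q , q<n , e

    incR′ : ∀ p q → L ≤ p → p < q → q < n → t′ p ≺ t′ q
    incR′ p q L≤p p<q q<n with view p | view q
    ... | below p<i _ | _ = absurd-<≥ p<i (≤-trans i≤L L≤p)
    ... | shifted _ _ e₁ | shifted _ q<P e₂ =
      along _≺_ e₁ e₂ (incR _ _ (L<⇒l≤ (s≤s L≤p)) (s≤s p<q) (<-≤-trans (s≤s q<P) 1+P≤n))
    ... | shifted i≤p p<P e₁ | at e₂ = along _≺_ e₁ e₂ (≺-upto-P (s≤s i≤p) p<P)
    ... | shifted _ p<P e₁ | above P<q e₂ = along _≺_ e₁ e₂ (incR _ q (L<⇒l≤ (s≤s L≤p)) (≤-<-trans p<P P<q) q<n)
    ... | at e₁ | above P<q e₂ = along _≺_ e₁ e₂ (≻-after-P P<q q<n)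
    ... | above P<p e₁ | above _ e₂ = along _≺_ e₁ e₂ (incR p q (L<⇒l≤ (≤-<-trans L≤P P<p)) p<q q<n)
    ... | shifted i≤p _ _ | below q<i _ = absurd-<≥ q<i (≤-trans i≤p (<⇒≤ p<q))
    ... | at _ | below q<i _ = absurd-<≥ q<i (≤-trans i≤P (<⇒≤ p<q))
    ... | at _ | shifted _ q<P _ = absurd-<≥ p<q (<⇒≤ q<P)
    ... | at _ | at _ = absurd-<≥ p<q ≤-refl
    ... | above P<p _ | below q<i _ = absurd-<≥ q<i (≤-trans i≤P (<⇒≤ (<-trans P<p p<q)))
    ... | above P<p _ | shifted _ q<P _ = absurd-<≥ q<P (<⇒≤ (<-trans P<p p<q))
    ... | above P<p _ | at _ = absurd-<≥ p<q (<⇒≤ P<p)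

    decL′ : ∀ p q → p < q → q < L → t′ q ≺ t′ p
    decL′ p q p<q q<L with view p | view q
    ... | _ | at _ = absurd-<≥ q<L L≤P
    ... | _ | above P<q _ = absurd-<≥ q<L (≤-trans L≤P (<⇒≤ P<q))
    ... | at _ | _ = absurd-<≥ (<-trans p<q q<L) L≤P
    ... | above P<p _ | _ = absurd-<≥ (<-trans p<q q<L) (≤-trans L≤P (<⇒≤ P<p))
    ... | below _ e₁ | below _ e₂ = along _≺_ e₂ e₁ (decL p q p<q (<-trans (n<1+n q) (<L⇒1+<l q<L)))
    ... | below _ e₁ | shifted _ _ e₂ = along _≺_ e₂ e₁ (decL p _ (m<n⇒m<1+n p<q) (<L⇒1+<l q<L))
    ... | shifted _ _ e₁ | shifted _ _ e₂ = along _≺_ e₂ e₁ (decL _ _ (s≤s p<q) (<L⇒1+<l q<L))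
    ... | shifted i≤p _ _ | below q<i _ = absurd-<≥ q<i (≤-trans i≤p (<⇒≤ p<q))

    m-pos′ : ∀ q → q < L → 0 < mOf (t′ q)
    m-pos′ q q<L with view q
    ... | below q<i e = subst (λ x → 0 < mOf x) (sym e) (m-pos q (<-trans q<i i<l))
    ... | shifted _ _ e = subst (λ x → 0 < mOf x) (sym e) (m-pos _ (<L⇒1+<l q<L))
    ... | at _ = absurd-<≥ q<L L≤P
    ... | above P<q _ = absurd-<≥ q<L (≤-trans L≤P (<⇒≤ P<q))

    b-dist′ : ∀ p q → p < q → q < n → Compatible k (t′ p) (t′ q)
    b-dist′ p q p<q q<n with view p | view q
    ... | below _ e₁ | below _ e₂ = along (Compatible k) e₁ e₂ (b-dist p q p<q q<n)
    ... | below _ e₁ | shifted _ q<P e₂ =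
      along (Compatible k) e₁ e₂ (b-dist p _ (m<n⇒m<1+n p<q) (<-≤-trans (s≤s q<P) 1+P≤n))
    ... | below p<i e₁ | at e₂ = along (Compatible k) e₁ e₂ (b-dist p i p<i i<n)
    ... | below _ e₁ | above _ e₂ = along (Compatible k) e₁ e₂ (b-dist p q p<q q<n)
    ... | shifted _ _ e₁ | shifted _ q<P e₂ =
      along (Compatible k) e₁ e₂ (b-dist _ _ (s≤s p<q) (<-≤-trans (s≤s q<P) 1+P≤n))
    ... | shifted i≤p p<P e₁ | at e₂ = along (Compatible k) e₁ e₂
      (far⇒compatible {k} {t (suc p)} {t i}
        (inj₁ (unsupported (suc p) (<-≤-trans (s≤s p<P) 1+P≤n) (≺-upto-P (s≤s i≤p) p<P))))
    ... | shifted _ p<P e₁ | above P<q e₂ = along (Compatible k) e₁ e₂ (b-dist _ q (≤-<-trans p<P P<q) q<n)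
    ... | at e₁ | above P<q e₂ = along (Compatible k) e₁ e₂ (b-dist i q (≤-<-trans i≤P P<q) q<n)
    ... | above _ e₁ | above _ e₂ = along (Compatible k) e₁ e₂ (b-dist p q p<q q<n)
    ... | shifted i≤p _ _ | below q<i _ = absurd-<≥ q<i (≤-trans i≤p (<⇒≤ p<q))
    ... | at _ | below q<i _ = absurd-<≥ q<i (≤-trans i≤P (<⇒≤ p<q))
    ... | at _ | shifted _ q<P _ = absurd-<≥ p<q (<⇒≤ q<P)
    ... | at _ | at _ = absurd-<≥ p<q ≤-refl
    ... | above P<p _ | below q<i _ = absurd-<≥ q<i (≤-trans i≤P (<⇒≤ (<-trans P<p p<q)))
    ... | above P<p _ | shifted _ q<P _ = absurd-<≥ q<P (<⇒≤ (<-trans P<p p<q))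
    ... | above P<p _ | at _ = absurd-<≥ p<q (<⇒≤ P<p)

    moved-InA : InA n k (cfg L t′)
    moved-InA = record
      { l≤n = ≤-trans (m≤m+n L R) (≤-trans (n≤1+n P) 1+P≤n)
      ; a-pos = λ q q<n → let (q′ , q′<n , e) = entries q<n in subst (λ x → 1 ≤ aOf x) (sym e) (a-pos q′ q′<n)
      ; b-pos = λ q q<n → let (q′ , q′<n , e) = entries q<n in subst (λ x → 1 ≤ bOf x) (sym e) (b-pos q′ q′<n)
      ; incR = incR′
      ; decL = decL′
      ; m-pos = m-pos′
      ; b-dist = b-dist′
      }

  movable : 1 ≤ k → ∀ {i} → i < n → Unsupported i → i < l ⊎ (l ≤ i × 0 < mAt i) → Movable n k (cfg l t) i
  movable 1≤k {i} i<n unsupported side = moved side , λ j j<n σj<σi →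
    d-nonpositive k (cfg l t) i j 1≤k (unsupported j j<n (σ<⇒≺ i<n σj<σi))
    where
      moved : i < l ⊎ (l ≤ i × 0 < mAt i) → InA n k (move n (cfg l t) i)
      moved (inj₁ i<l) = subst (InA n k) (sym (move-fromLeft {n} i<l)) (MoveRight.moved-InA 1≤k i<l unsupported)
      moved (inj₂ (l≤i , 0<mi)) =
        subst (InA n k) (sym (move-fromRight {n} l≤i)) (MoveLeft.moved-InA 1≤k l≤i i<n 0<mi unsupported)

  module Immovable (1≤k : 1 ≤ k) (immovable : ∀ i → i < n → ¬ Movable n k (cfg l t) i) where

    unsupported⇒right∧m≡0 : ∀ {q} → q < n → Unsupported q → l ≤ q × mAt q ≡ 0
    unsupported⇒right∧m≡0 {q} q<n unsupported with q <? l | mAt q ≟ 0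
    ... | yes q<l | _ = ⊥-elim (immovable q q<n (movable 1≤k q<n unsupported (inj₁ q<l)))
    ... | no q≮l | yes mq≡0 = ≮⇒≥ q≮l , mq≡0
    ... | no q≮l | no mq≢0 =
      ⊥-elim (immovable q q<n (movable 1≤k q<n unsupported (inj₂ (≮⇒≥ q≮l , n≢0⇒n>0 mq≢0))))

    supported : ∀ {q} → q < n → (∃ λ j → j < n × t j ≺ t q × mAt q ≤ mAt j + k) ⊎ (l ≤ q × mAt q ≡ 0)
    supported {q} q<n with search< (λ j → (t j ≺? t q) ×-dec (mAt q ≤? mAt j + k)) n
    ... | inj₁ (j , j<n , j≺q , mq≤) = inj₁ (j , j<n , j≺q , mq≤)
    ... | inj₂ none =
      inj₂ (unsupported⇒right∧m≡0 q<n (λ j j<n j≺q → ≰⇒> (λ mq≤ → none j j<n (j≺q , mq≤))))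

    -- Along a supporting chain m grows by at most k per strict increase of a, and not at all otherwise.
    m≤k*rank : (rank : ℕ → ℕ) → (∀ {p q} → p < n → q < n → aAt p < aAt q → rank (aAt p) < rank (aAt q)) →
      ∀ {q} → q < n → mAt q ≤ k * rank (aAt q)
    m≤k*rank rank rank-mono q<n = bound _ q<n ≤-refl
      where
        bound : ∀ s {q} → q < n → σ n (cfg l t) q ≤ s → mAt q ≤ k * rank (aAt q)
        bound zero _ ()
        bound (suc s) {q} q<n σq≤1+s with supported q<n
        ... | inj₂ (_ , mq≡0) = subst (_≤ k * rank (aAt q)) (sym mq≡0) z≤n
        ... | inj₁ (j , j<n , j≺q , mq≤mj+k) with ≺⇒a<⊎m≥ j≺q
        ...   | inj₂ (aj≡aq , mq≤mj) = ≤-trans mq≤mj (subst (λ a → mAt j ≤ k * rank a) aj≡aq (bound s j<n σj≤s))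
          where
            σj≤s : σ n (cfg l t) j ≤ s
            σj≤s = ≤-pred (<-≤-trans (≺⇒σ< j<n j≺q) σq≤1+s)
        ...   | inj₁ aj<aq = begin
          mAt q                  ≤⟨ mq≤mj+k ⟩
          mAt j + k              ≤⟨ +-monoˡ-≤ k (bound s j<n σj≤s) ⟩
          k * rank (aAt j) + k   ≡⟨ +-comm _ k ⟩
          k + k * rank (aAt j)   ≡⟨ *-suc k _ ⟨
          k * suc (rank (aAt j)) ≤⟨ *-monoʳ-≤ k (rank-mono j<n q<n aj<aq) ⟩
          k * rank (aAt q)       ∎
          where
            open ≤-Reasoning
            σj≤s : σ n (cfg l t) j ≤ s
            σj≤s = ≤-pred (<-≤-trans (≺⇒σ< j<n j≺q) σq≤1+s)

-- Values with gaps in a bounded window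

shift-bound : ∀ {k d c u} → k ≤ u → d + k * c < (u ∸ k) + k → d + k * suc c < u + k
shift-bound {k} {d} {c} {u} k≤u bound = begin-strict
  d + k * suc c       ≡⟨ cong (d +_) (*-suc k c) ⟩
  d + (k + k * c)     ≡⟨ +-assoc d k (k * c) ⟨
  (d + k) + k * c     ≡⟨ cong (_+ k * c) (+-comm d k) ⟩
  (k + d) + k * c     ≡⟨ +-assoc k d (k * c) ⟩
  k + (d + k * c)     <⟨ +-monoʳ-< k bound ⟩
  k + ((u ∸ k) + k)   ≡⟨ +-assoc k (u ∸ k) k ⟨
  (k + (u ∸ k)) + k   ≡⟨ cong (_+ k) (m+[n∸m]≡n k≤u) ⟩
  u + k               ∎
  where open ≤-Reasoning

module GapCounting {I : ℕ → Set} (I? : ∀ q → Dec (I q)) (n l k : ℕ) (1≤k : 1 ≤ k) (mm : ℕ → ℕ)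
  (gap : ∀ {p q} → p < q → q < n → I p → I q → mm p + k ≤ mm q ⊎ mm q + k < mm p)
  (left-pos : ∀ {q} → q < l → I q → 0 < mm q) where

  I-below : ℕ → ℕ → Bool
  I-below v q = does (I? q ×-dec (mm q <? v))

  N : ℕ → ℕ
  N v = count (I-below v) n

  private
    I-below-cong : ∀ {v w q} → (I q → mm q < v → mm q < w) → (I q → mm q < w → mm q < v) →
      I-below v q ≡ I-below w q
    I-below-cong {v} {w} {q} v⇒w w⇒v =
      does-⇔ (mk⇔ (λ (iq , lt) → iq , v⇒w iq lt) (λ (iq , lt) → iq , w⇒v iq lt))
        (I? q ×-dec (mm q <? v)) (I? q ×-dec (mm q <? w))

  N-zero : N 0 ≡ 0
  N-zero = count-none n (λ q _ → dec-false (I? q ×-dec (mm q <? 0)) (λ ()))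

  N-all : ∀ {V} → (∀ q → q < n → I q → mm q < V) → N V ≡ count (λ q → does (I? q)) n
  N-all {V} all<V = count-cong n (λ q q<n →
    does-⇔ (mk⇔ proj₁ (λ iq → iq , all<V q q<n iq)) (I? q ×-dec (mm q <? V)) (I? q))

  N-skip : ∀ {v} → (∀ q → q < n → I q → mm q ≢ v) → N (suc v) ≡ N v
  N-skip none = count-cong n (λ q q<n →
    I-below-cong (λ iq mq<1+v → ≤∧≢⇒< (≤-pred mq<1+v) (none q q<n iq)) (λ _ → m<n⇒m<1+n))

  N-step : ∀ {x v w} → x < n → I x → mm x ≡ v → w ≤ v →
    (∀ y → y < n → I y → y ≢ x → mm y < suc v → mm y < w) → N (suc v) ≡ suc (N w)
  N-step {x} {v} {w} x<n ix mx≡v w≤v others = count-switchOn n x x<n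
    (dec-false (I? x ×-dec (mm x <? w)) (λ (_ , mx<w) → <⇒≱ mx<w (subst (w ≤_) (sym mx≡v) w≤v)))
    (dec-true (I? x ×-dec (mm x <? suc v)) (ix , s≤s (≤-reflexive mx≡v)))
    (λ y y<n y≢x → I-below-cong (λ _ my<w → ≤-trans my<w (m≤n⇒m≤1+n w≤v)) (λ iy → others y y<n iy y≢x))

  -- q sits left of the line, or before some p with a smaller value: either way q wastes room.
  Wasteful : ℕ → Set
  Wasteful v = ∃ λ q → q < n × I q × mm q < v × (q < l ⊎ ∃ λ p → p < n × I p × q < p × mm p < mm q)

  -- Each element below v needs k of the units in [0, v + k), and a wasteful one leaves one more unused.
  Claim : ℕ → Set
  Claim v = k * N v < v + k × (Wasteful v → suc (k * N v) < v + k)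

  private
    gap-sym : ∀ {p q} → p < n → q < n → p ≢ q → I p → I q → mm p + k ≤ mm q ⊎ mm q + k ≤ mm p
    gap-sym {p} {q} p<n q<n p≢q ip iq with <-cmp p q
    ... | tri< p<q _ _ = map₂ <⇒≤ (gap p<q q<n ip iq)
    ... | tri≈ _ p≡q _ = ⊥-elim (p≢q p≡q)
    ... | tri> _ _ q<p = swap (map₂ <⇒≤ (gap q<p p<n iq ip))

    not-wasteful-0 : ¬ Wasteful 0
    not-wasteful-0 (_ , _ , _ , () , _)

    x+k≰x : ∀ {x} → ¬ (x + k ≤ x)
    x+k≰x {x} = <⇒≱ (m<m+n x 1≤k)

  claim-zero : Claim 0
  claim-zero rewrite N-zero | *-zeroʳ k = 1≤k , λ w → ⊥-elim (not-wasteful-0 w)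

  claim-skip : ∀ {v} → (∀ q → q < n → I q → mm q ≢ v) → Claim v → Claim (suc v)
  claim-skip {v} none (bound , strict) rewrite N-skip none = m<n⇒m<1+n bound , λ w → m<n⇒m<1+n (strict (lower w))
    where
      lower′ : ∀ {q} → q < n → I q → mm q < suc v → mm q < v
      lower′ {q} q<n iq mq≤v = ≤∧≢⇒< (≤-pred mq≤v) (none q q<n iq)
      lower : Wasteful (suc v) → Wasteful v
      lower (q , q<n , iq , mq≤v , why) = q , q<n , iq , lower′ q<n iq mq≤v , why

  module Top {x v : ℕ} (x<n : x < n) (ix : I x) (mx≡v : mm x ≡ v) (rec : ∀ {u} → u < suc v → Claim u) where

    others : ∀ y → y < n → I y → y ≢ x → mm y < suc v → mm y + k ≤ v
    others y y<n iy y≢x my≤v with gap-sym y<n x<n y≢x iy ix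
    ... | inj₁ y+k≤x = subst (mm y + k ≤_) mx≡v y+k≤x
    ... | inj₂ x+k≤y = ⊥-elim (x+k≰x (≤-trans (subst (λ z → z + k ≤ mm y) mx≡v x+k≤y) (≤-pred my≤v)))

    w : ℕ
    w = suc v ∸ k

    w<1+v : w < suc v
    w<1+v = s≤s (∸-monoʳ-≤ (suc v) 1≤k)

    others<w : ∀ {y} → y < n → I y → y ≢ x → mm y < suc v → mm y < w
    others<w {y} y<n iy y≢x my≤v = m+n≤o⇒m≤o∸n (suc (mm y)) (s≤s (others y y<n iy y≢x my≤v))

    N≡1+N[w] : N (suc v) ≡ suc (N w)
    N≡1+N[w] = N-step x<n ix mx≡v (≤-pred w<1+v) (λ y y<n → others<w y<n)

    bound : k * N (suc v) < suc v + k
    bound rewrite N≡1+N[w] with k ≤? suc v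
    ... | yes k≤1+v = shift-bound {d = 0} k≤1+v (proj₁ (rec w<1+v))
    ... | no k≰1+v rewrite m≤n⇒m∸n≡0 (<⇒≤ (≰⇒> k≰1+v)) | N-zero | *-identityʳ k = m<n+m k z<s

    strict-from-w : Wasteful w → suc (k * N (suc v)) < suc v + k
    strict-from-w waste rewrite N≡1+N[w] with k ≤? suc v
    ... | yes k≤1+v = shift-bound {d = 1} k≤1+v (proj₂ (rec w<1+v) waste)
    ... | no k≰1+v = ⊥-elim (not-wasteful-0 (subst Wasteful (m≤n⇒m∸n≡0 (<⇒≤ (≰⇒> k≰1+v))) waste))

    TopWasteful : Set
    TopWasteful = x < l ⊎ ∃ λ p → p < n × I p × x < p × mm p < v

    classify : Wasteful (suc v) → Wasteful w ⊎ TopWasteful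
    classify (q , q<n , iq , mq≤v , why) with q ≟ x | why
    ... | yes refl | inj₁ q<l = inj₂ (inj₁ q<l)
    ... | yes refl | inj₂ (p , p<n , ip , q<p , mp<mq) = inj₂ (inj₂ (p , p<n , ip , q<p , subst (mm p <_) mx≡v mp<mq))
    ... | no q≢x | inj₁ q<l = inj₁ (q , q<n , iq , others<w q<n iq q≢x mq≤v , inj₁ q<l)
    ... | no q≢x | inj₂ (p , p<n , ip , q<p , mp<mq) with p ≟ x
    ...   | yes refl = ⊥-elim (<⇒≱ mp<mq (subst (mm q ≤_) (sym mx≡v) (≤-pred mq≤v)))
    ...   | no _ = inj₁ (q , q<n , iq , others<w q<n iq q≢x mq≤v , inj₂ (p , p<n , ip , q<p , mp<mq))

    v-positive : TopWasteful → 0 < v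
    v-positive (inj₁ x<l) = subst (0 <_) mx≡v (left-pos x<l ix)
    v-positive (inj₂ (_ , _ , _ , _ , mp<v)) = ≤-<-trans z≤n mp<v

    wasteful-below : ∀ {z} → z < n → I z → mm z + k ≡ v → TopWasteful → Wasteful w
    wasteful-below {z} z<n iz z+k≡v top = z , z<n , iz , m+n≤o⇒m≤o∸n (suc (mm z)) (s≤s (≤-reflexive z+k≡v)) , why top
      where
        z<x : z < x
        z<x with <-cmp z x
        ... | tri< z<x _ _ = z<x
        ... | tri≈ _ refl _ = ⊥-elim (x+k≰x (≤-reflexive (trans z+k≡v (sym mx≡v))))
        ... | tri> _ _ x<z with gap x<z z<n ix iz
        ...   | inj₁ x+k≤z = ⊥-elim (x+k≰x (≤-trans (subst (λ a → a + k ≤ mm z) mx≡v x+k≤z)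
                                             (≤-trans (m≤m+n (mm z) k) (≤-reflexive z+k≡v))))
        ...   | inj₂ z+k<x = ⊥-elim (<-irrefl (trans z+k≡v (sym mx≡v)) z+k<x)
        why : TopWasteful → z < l ⊎ ∃ λ p → p < n × I p × z < p × mm p < mm z
        why (inj₁ x<l) = inj₁ (<-trans z<x x<l)
        why (inj₂ (p , p<n , ip , x<p , mp<v)) with gap (<-trans z<x x<p) p<n iz ip
        ... | inj₁ z+k≤p = ⊥-elim (<⇒≱ mp<v (subst (_≤ mm p) z+k≡v z+k≤p))
        ... | inj₂ p+k<z = inj₂ (p , p<n , ip , <-trans z<x x<p , ≤-<-trans (m≤m+n (mm p) k) p+k<z)

    -- With nothing exactly k below x, the others fit below v ∸ k and one unit of room is lost.
    N≡1+N[v∸k] : (∀ y → y < n → I y → mm y + k ≢ v) → N (suc v) ≡ suc (N (v ∸ k))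
    N≡1+N[v∸k] none = N-step x<n ix mx≡v (m∸n≤m v k) (λ y y<n iy y≢x my≤v →
      m+n≤o⇒m≤o∸n (suc (mm y)) (≤∧≢⇒< (others y y<n iy y≢x my≤v) (none y y<n iy)))

    strict-isolated : (∀ y → y < n → I y → mm y + k ≢ v) → TopWasteful → suc (k * N (suc v)) < suc v + k
    strict-isolated none top rewrite N≡1+N[v∸k] none with k ≤? v
    ... | yes k≤v = s≤s (shift-bound {d = 0} k≤v (proj₁ (rec (s≤s (m∸n≤m v k)))))
    ... | no k≰v rewrite m≤n⇒m∸n≡0 (<⇒≤ (≰⇒> k≰v)) | N-zero | *-identityʳ k = s≤s (m<n+m k (v-positive top))

    strict-top : TopWasteful → suc (k * N (suc v)) < suc v + k
    strict-top top with search< (λ z → I? z ×-dec (mm z + k ≟ v)) n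
    ... | inj₁ (z , z<n , iz , z+k≡v) = strict-from-w (wasteful-below z<n iz z+k≡v top)
    ... | inj₂ none = strict-isolated (λ y y<n iy e → none y y<n (iy , e)) top

  claim : ∀ v → Claim v
  claim = <-rec Claim step
    where
      step : ∀ v → (∀ {u} → u < v → Claim u) → Claim v
      step zero _ = claim-zero
      step (suc v) rec with search< (λ x → I? x ×-dec (mm x ≟ v)) n
      ... | inj₂ none = claim-skip (λ q q<n iq e → none q q<n (iq , e)) (rec ≤-refl)
      ... | inj₁ (x , x<n , ix , mx≡v) = bound , λ waste → [ strict-from-w , strict-top ] (classify waste)
        where open Top x<n ix mx≡v rec

  module _ {r : ℕ} (bounded : ∀ q → q < n → I q → mm q ≤ k * r) where

    private
      instance
        k≢0 : NonZero k
        k≢0 = >-nonZero 1≤k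

      V : ℕ
      V = suc (k * r)

      N[V] : N V ≡ count (λ q → does (I? q)) n
      N[V] = N-all (λ q q<n iq → s≤s (bounded q q<n iq))

      V+k≡1+k*[1+r] : V + k ≡ suc (k * suc r)
      V+k≡1+k*[1+r] = cong suc (trans (+-comm (k * r) k) (sym (*-suc k r)))

    count-≤ : count (λ q → does (I? q)) n ≤ suc r
    count-≤ = *-cancelˡ-≤ k (subst (λ c → k * c ≤ k * suc r) N[V]
      (≤-pred (subst (k * N V <_) V+k≡1+k*[1+r] (proj₁ (claim V)))))

    private
      count-≡⇒¬wasteful : count (λ q → does (I? q)) n ≡ suc r → ¬ Wasteful V
      count-≡⇒¬wasteful tight waste = <-irrefl (trans N[V] tight)
        (*-cancelˡ-< k (N V) (suc r) (≤-pred (subst (suc (k * N V) <_) V+k≡1+k*[1+r] (proj₂ (claim V) waste))))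

    count-≡⇒right : count (λ q → does (I? q)) n ≡ suc r → ∀ {q} → q < n → I q → l ≤ q
    count-≡⇒right tight {q} q<n iq =
      ≮⇒≥ λ q<l → count-≡⇒¬wasteful tight (q , q<n , iq , s≤s (bounded q q<n iq) , inj₁ q<l)

    count-≡⇒forward : count (λ q → does (I? q)) n ≡ suc r → ∀ {p q} → p < q → q < n → I p → I q → mm p + k ≤ mm q
    count-≡⇒forward tight {p} {q} p<q q<n ip iq with gap p<q q<n ip iq
    ... | inj₁ p+k≤q = p+k≤q
    ... | inj₂ q+k<p = ⊥-elim (count-≡⇒¬wasteful tight
      (p , <-trans p<q q<n , ip , s≤s (bounded p (<-trans p<q q<n) ip) ,
       inj₂ (q , q<n , iq , p<q , ≤-<-trans (m≤m+n (mm q) k) q+k<p)))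

rank : ℕ → List ℕ → ℕ
rank x ys = length (filter (_<? x) ys)

rank-∷ : ∀ x y ys → rank x (y ∷ ys) ≤ suc (rank x ys)
rank-∷ x y ys with y <ᵇ x
... | true = ≤-refl
... | false = n≤1+n _

rank-mono : ∀ {x y} ys → x ≤ y → rank x ys ≤ rank y ys
rank-mono [] _ = z≤n
rank-mono {x} {y} (z ∷ zs) x≤y with z <ᵇ x | <ᵇ-reflects-< z x | z <ᵇ y | <ᵇ-reflects-< z y
... | true | _ | true | _ = s≤s (rank-mono zs x≤y)
... | true | ofʸ z<x | false | ofⁿ z≮y = ⊥-elim (z≮y (<-≤-trans z<x x≤y))
... | false | _ | true | _ = m≤n⇒m≤1+n (rank-mono zs x≤y)
... | false | _ | false | _ = rank-mono zs x≤y

rank-strict : ∀ {x y ys} → x ∈ ys → x < y → rank x ys < rank y ys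
rank-strict {x} {y} {z ∷ zs} (here refl) x<y with x <ᵇ x | <ᵇ-reflects-< x x | x <ᵇ y | <ᵇ-reflects-< x y
... | true | ofʸ x<x | _ | _ = ⊥-elim (<-irrefl refl x<x)
... | false | _ | true | _ = s≤s (rank-mono zs (<⇒≤ x<y))
... | false | _ | false | ofⁿ x≮y = ⊥-elim (x≮y x<y)
rank-strict {x} {y} {z ∷ zs} (there x∈zs) x<y with z <ᵇ x | <ᵇ-reflects-< z x | z <ᵇ y | <ᵇ-reflects-< z y
... | true | _ | true | _ = s≤s (rank-strict x∈zs x<y)
... | true | ofʸ z<x | false | ofⁿ z≮y = ⊥-elim (z≮y (<-trans z<x x<y))
... | false | _ | true | _ = m<n⇒m<1+n (rank-strict x∈zs x<y)
... | false | _ | false | _ = rank-strict x∈zs x<y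

rank-take : ∀ {x} r ys → Sorted ys → x ∈ take r ys → rank x ys < r
rank-take {x} (suc r) (x ∷ ys) sorted (here refl)
  rewrite filter-none (_<? x) (All.map ≤⇒≯ (Linked⇒All ≤-trans ≤-refl sorted)) = z<s
rank-take {x} (suc r) (y ∷ ys) sorted (there x∈) =
  ≤-<-trans (rank-∷ x y ys) (s≤s (rank-take r ys (Linked.tail sorted) x∈))

get-lookup : ∀ {n} (v : Vec ℕ n) (i : Fin n) → lookup v i ≡ get v (toℕ i)
get-lookup (x ∷ v) Fin.zero = refl
get-lookup (x ∷ v) (Fin.suc i) = get-lookup v i

get-∈ : ∀ {n} (v : Vec ℕ n) {q} → q < n → get v q ∈ toList v
get-∈ (x ∷ v) {zero} _ = here refl
get-∈ (x ∷ v) {suc q} (s≤s q<n) = there (get-∈ v q<n)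

count-front : ∀ (f : ℕ → Bool) n → count f (suc n) ≡ (if f 0 then 1 else 0) + count (f ∘ suc) n
count-front f zero = refl
count-front f (suc n) rewrite count-front f n =
  x∙yz≈y∙xz (if f (suc n) then 1 else 0) (if f 0 then 1 else 0) (count (f ∘ suc) n)

length-filter-tabulate : ∀ {A : Set} {P : A → Set} (P? : ∀ x → Dec (P x)) n (h : Fin n → A) (f : ℕ → Bool) →
  (∀ i → does (P? (h i)) ≡ f (toℕ i)) → length (filter P? (tabulate h)) ≡ count f n
length-filter-tabulate P? zero h f agree = refl
length-filter-tabulate P? (suc n) h f agree with does (P? (h Fin.zero)) | agree Fin.zero
... | true | f0 rewrite count-front f n | sym f0 =
  cong suc (length-filter-tabulate P? n (h ∘ Fin.suc) (f ∘ suc) (agree ∘ Fin.suc))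
... | false | f0 rewrite count-front f n | sym f0 =
  length-filter-tabulate P? n (h ∘ Fin.suc) (f ∘ suc) (agree ∘ Fin.suc)

-- The sets I_{r,β}

module Occurrences {n k l : ℕ} (1≤k : 1 ≤ k) {a m b : Vec ℕ n} (A′ : InA' n k (mkA l a m b)) (r′ β : ℕ) where
  open Configuration (proj₁ A′)
  open Immovable 1≤k (proj₂ A′)

  InIℕ : ℕ → Set
  InIℕ q = get a q ∈ take (suc r′) (distinctValues a) × get b q ≡ β

  InIℕ? : ∀ q → Dec (InIℕ q)
  InIℕ? q = (get a q ∈? take (suc r′) (distinctValues a)) ×-dec (get b q ≟ β)

  cardI≡count : cardI a b (suc r′) β ≡ count (λ q → does (InIℕ? q)) n
  cardI≡count = length-filter-tabulate (InI? a b (suc r′) β) n (λ i → i) (λ q → does (InIℕ? q)) (λ i →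
    cong₂ (λ x y → does ((x ∈? take (suc r′) (distinctValues a)) ×-dec (y ≟ β))) (get-lookup a i) (get-lookup b i))

  InI⇒InIℕ : ∀ {i} → InI a b (suc r′) β i → InIℕ (toℕ i)
  InI⇒InIℕ {i} (a∈ , b≡β) = subst (_∈ _) (get-lookup a i) a∈ , trans (sym (get-lookup b i)) b≡β

  occurs : ∀ {q} → q < n → get a q ∈ distinctValues a
  occurs q<n = ∈-resp-↭ (↭-sym (sort-↭ _)) (∈-deduplicate⁺ _≟_ (get-∈ a q<n))

  m-bounded : ∀ q → q < n → InIℕ q → mAt q ≤ k * r′
  m-bounded q q<n (a∈ , _) = ≤-trans
    (m≤k*rank (λ x → rank x (distinctValues a)) (λ p<n _ ap<aq → rank-strict (occurs p<n) ap<aq) q<n)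
    (*-monoʳ-≤ k (≤-pred (rank-take (suc r′) _ (sort-↗ _) a∈)))

  open GapCounting InIℕ? n l k 1≤k mAt (λ p<q q<n ip iq → b-gap p<q q<n (trans (proj₂ ip) (sym (proj₂ iq))))
    (λ q<l _ → InA.m-pos (proj₁ A′) _ q<l)

  cardI-≤ : cardI a b (suc r′) β ≤ suc r′
  cardI-≤ = subst (_≤ suc r′) (sym cardI≡count) (count-≤ m-bounded)

  module _ (tight : cardI a b (suc r′) β ≡ suc r′) where

    private
      tight′ : count (λ q → does (InIℕ? q)) n ≡ suc r′
      tight′ = trans (sym cardI≡count) tight

    right-of-line : (i : Fin n) → InI a b (suc r′) β i → l ≤ toℕ i
    right-of-line i i∈I = count-≡⇒right m-bounded tight′ (toℕ<n i) (InI⇒InIℕ i∈I)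

    a-increasing : ∀ (i j : Fin n) → toℕ i < toℕ j → InI a b (suc r′) β i → InI a b (suc r′) β j →
      lookup a i < lookup a j
    a-increasing i j i<j i∈I j∈I = subst₂ _<_ (sym (get-lookup a i)) (sym (get-lookup a j))
      (right-block-m<⇒a< (right-of-line i i∈I) i<j (toℕ<n j)
        (<-≤-trans (m<m+n _ 1≤k)
          (count-≡⇒forward m-bounded tight′ i<j (toℕ<n j) (InI⇒InIℕ i∈I) (InI⇒InIℕ j∈I))))

    rows-distinct : (i j : Fin n) → InI a b (suc r′) β i → InI a b (suc r′) β j → ¬ (i ≡ j) →
      ¬ (lookup a i ≡ lookup a j)
    rows-distinct i j i∈I j∈I i≢j with <-cmp (toℕ i) (toℕ j)
    ... | tri< i<j _ _ = <⇒≢ (a-increasing i j i<j i∈I j∈I)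
    ... | tri≈ _ i≡j _ = ⊥-elim (i≢j (toℕ-injective i≡j))
    ... | tri> _ _ j<i = ≢-sym (<⇒≢ (a-increasing j i j<i j∈I i∈I))

lemma4p14 : (n k : ℕ) → 1 ≤ n → 1 ≤ k →
  (l : ℕ) (a m b : Vec ℕ n) → InA' n k (mkA l a m b) →
  (r : ℕ) → 1 ≤ r → r ≤ length (distinctValues a) →
  (β : ℕ) → 1 ≤ β →
  (cardI a b r β ≤ r) ×
  (cardI a b r β ≡ r →
    ((i j : Fin n) → InI a b r β i → InI a b r β j → ¬ (i ≡ j) → ¬ (lookup a i ≡ lookup a j)) ×
    ((i : Fin n) → InI a b r β i → l ≤ toℕ i))
lemma4p14 n k _ 1≤k l a m b A′ (suc r′) _ _ β _ = cardI-≤ , λ tight → rows-distinct tight , right-of-line tight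
  where open Occurrences 1≤k {a} {m} {b} A′ r′ β
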